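{- Let $\mathcal{G}$ be a finite simple graph with vertex set $\mathcal{V}$. For $\mathcal{A}\subseteq\mathcal{V}$ let $\mathcal{B}_{\mathcal{A}}(\mathcal{G})=\mathcal{V}\setminus\mathcal{O}(\mathcal{A})$. For attribute subsets $\mathcal{A}_1,\mathcal{A}_2\subseteq\mathcal{V}$, we have $\gamma_{\mathcal{A}_1}(\mathcal{G})=\gamma_{\mathcal{A}_2}(\mathcal{G})$ if and only if one of the following holds: (1) $\mathcal{B}_{\mathcal{A}_1}(\mathcal{G})=\mathcal{B}_{\mathcal{A}_2}(\mathcal{G})$; (2) each of $\mathcal{B}_{\mathcal{A}_1}(\mathcal{G})$ and $\mathcal{B}_{\mathcal{A}_2}(\mathcal{G})$ is either empty or consists of exactly one orbit of $\mathcal{G}$.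
   Context: Orbits are taken under the automorphism group of $\mathcal{G}$: $\mathcal{O}(y)=\{\pi(y):\pi\in\mathrm{Aut}(\mathcal{G})\}$, and $\mathcal{O}(\mathcal{A})=\bigcup_{x\in\mathcal{A}}\mathcal{O}(x)$. For $\mathcal{A}\subseteq\mathcal{V}$, $x\equiv_{\mathcal{A}}y$ iff $\mathcal{O}(x)\cap\mathcal{A}=\mathcal{O}(y)\cap\mathcal{A}$, and $\gamma_{\mathcal{A}}(\mathcal{G})$ is the partition of $\mathcal{V}$ into the equivalence classes of $\equiv_{\mathcal{A}}$. -}

module Defs where

open import Data.Nat using (ℕ)
open import Data.Bool using (Bool; false)
open import Data.Fin using (Fin)
open import Data.Fin.Subset using (Subset; _∈_)
open import Data.Fin.Permutation using (Permutation′; _⟨$⟩ʳ_)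
open import Data.Product using (Σ; _×_; ∃; ∃-syntax)
open import Relation.Binary.PropositionalEquality using (_≡_)
open import Relation.Nullary using (¬_)
open import Level using (0ℓ)
open import Relation.Unary using (Pred)

record Graph (n : ℕ) : Set where
  field
    adj   : Fin n → Fin n → Bool
    sym   : ∀ i j → adj i j ≡ adj j i
    irrefl : ∀ i → adj i i ≡ false
open Graph public

IsAut : ∀ {n} → Graph n → Permutation′ n → Set
IsAut G π = ∀ i j → adj G (π ⟨$⟩ʳ i) (π ⟨$⟩ʳ j) ≡ adj G i j

InOrbit : ∀ {n} → Graph n → Fin n → Pred (Fin n) 0ℓ
InOrbit G y z = Σ (Permutation′ _) λ π → IsAut G π × (π ⟨$⟩ʳ y ≡ z)

InOrbitSet : ∀ {n} → Graph n → Subset n → Pred (Fin n) 0ℓ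
InOrbitSet G A z = ∃[ x ] (x ∈ A × InOrbit G x z)

InB : ∀ {n} → Graph n → Subset n → Pred (Fin n) 0ℓ
InB G A z = ¬ InOrbitSet G A z

_≃ₛ_ : ∀ {n} → Pred (Fin n) 0ℓ → Pred (Fin n) 0ℓ → Set
P ≃ₛ Q = ∀ z → (P z → Q z) × (Q z → P z)

EquivA : ∀ {n} → Graph n → Subset n → Fin n → Fin n → Set
EquivA G A x y = (λ z → InOrbit G x z × z ∈ A) ≃ₛ (λ z → InOrbit G y z × z ∈ A)

-- γ_{A₁}(G) = γ_{A₂}(G): the partitions into equivalence classes coincide,
-- i.e. the two equivalence relations coincide.
SamePartition : ∀ {n} → Graph n → Subset n → Subset n → Set
SamePartition G A₁ A₂ = ∀ x y → (EquivA G A₁ x y → EquivA G A₂ x y) × (EquivA G A₂ x y → EquivA G A₁ x y)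

IsEmpty : ∀ {n} → Pred (Fin n) 0ℓ → Set
IsEmpty P = ∀ z → ¬ P z

IsOneOrbit : ∀ {n} → Graph n → Pred (Fin n) 0ℓ → Set
IsOneOrbit G P = ∃[ y ] (P ≃ₛ InOrbit G y)

{-# OPTIONS --safe #-}
-- Two vertices are ≡_A-equivalent exactly when they lie in one orbit or both
-- lie in B_A, which is a union of orbits; so γ_A is the orbit partition with
-- the orbits inside B_A merged into a single block. If B_{A₁} ≠ B_{A₂}, a vertex
-- z in (say) B_{A₁} \ B_{A₂} is ≡_{A₁}-related to all of B_{A₁} but
-- ≡_{A₂}-related only to its own orbit, which forces B_{A₁} = O(z); and two
-- vertices of B_{A₂} in different orbits would have to lie in B_{A₁} = O(z),
-- i.e. in B_{A₂} together with z. Conversely, when B_A is empty or one orbit,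
-- merging changes nothing and γ_A is just the orbit partition.
-- Orbit membership quantifies over all automorphisms; it is decided by
-- searching the finitely many lookup tables of a permutation and its inverse.
module Submission where

open import Defs hiding (sym)
open import Data.Nat using (ℕ; zero; suc)
import Data.Bool.Properties as Bool
open import Data.Fin using (Fin; _≟_)
open import Data.Fin.Subset using (Subset)
open import Data.Fin.Subset.Properties using (_∈?_)
open import Data.Fin.Properties using (any?; all?)
open import Data.Fin.Permutation
  using (_⟨$⟩ʳ_; _⟨$⟩ˡ_; permutation; inverseˡ; inverseʳ; flip; _∘ₚ_; id)
open import Data.Vec using (Vec; []; _∷_; lookup; tabulate)
open import Data.Vec.Properties using (lookup∘tabulate)
open import Data.Product using (_×_; _,_; proj₁; proj₂; ∃; ∃-syntax; swap)
open import Data.Sum using (_⊎_; inj₁; inj₂)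
open import Data.Empty using (⊥-elim)
open import Function using (_∘_)
open import Level using (0ℓ)
open import Relation.Nullary using (¬_; Dec; yes; no)
open import Relation.Nullary.Decidable using (map′; _×-dec_; _⊎-dec_; ¬?; decidable-stable)
open import Relation.Unary using (Pred; Decidable)
open import Relation.Binary.PropositionalEquality
  using (_≡_; refl; sym; trans; cong; cong₂; module ≡-Reasoning)

anyVec? : ∀ {k} m {P : Vec (Fin k) m → Set} → Decidable P → Dec (∃ P)
anyVec? zero    P? = map′ ([] ,_) (λ { ([] , p) → p }) (P? [])
anyVec? (suc m) P? = map′ (λ { (a , v , p) → a ∷ v , p }) (λ { (a ∷ v , p) → a , v , p })
  (any? λ a → anyVec? m (λ v → P? (a ∷ v)))

≃ₛ-sym : ∀ {n} {P Q : Pred (Fin n) 0ℓ} → P ≃ₛ Q → Q ≃ₛ P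
≃ₛ-sym P≃Q z = proj₂ (P≃Q z) , proj₁ (P≃Q z)

≃ₛ⊎differ : ∀ {n} {P Q : Pred (Fin n) 0ℓ} → Decidable P → Decidable Q →
  (P ≃ₛ Q) ⊎ ∃[ z ] (P z × ¬ Q z ⊎ Q z × ¬ P z)
≃ₛ⊎differ P? Q? with any? (λ z → (P? z ×-dec ¬? (Q? z)) ⊎-dec (Q? z ×-dec ¬? (P? z)))
... | yes differ = inj₂ differ
... | no ¬differ = inj₁ λ z →
  (λ p → decidable-stable (Q? z) (λ ¬q → ¬differ (z , inj₁ (p , ¬q)))) ,
  (λ q → decidable-stable (P? z) (λ ¬p → ¬differ (z , inj₂ (q , ¬p))))

module _ {n : ℕ} (G : Graph n) where

  private
    _~_ : Fin n → Fin n → Set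
    _~_ = InOrbit G

  IsAut-flip : ∀ {π} → IsAut G π → IsAut G (flip π)
  IsAut-flip {π} aut i j = begin
    adj G (π ⟨$⟩ˡ i) (π ⟨$⟩ˡ j)                      ≡⟨ aut (π ⟨$⟩ˡ i) (π ⟨$⟩ˡ j) ⟨
    adj G (π ⟨$⟩ʳ (π ⟨$⟩ˡ i)) (π ⟨$⟩ʳ (π ⟨$⟩ˡ j))  ≡⟨ cong₂ (adj G) (inverseʳ π) (inverseʳ π) ⟩
    adj G i j                                       ∎
    where open ≡-Reasoning

  IsAut-∘ₚ : ∀ {π ρ} → IsAut G π → IsAut G ρ → IsAut G (π ∘ₚ ρ)
  IsAut-∘ₚ {π} autπ autρ i j = trans (autρ (π ⟨$⟩ʳ i) (π ⟨$⟩ʳ j)) (autπ i j)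

  InOrbit-refl : ∀ x → x ~ x
  InOrbit-refl x = id , (λ _ _ → refl) , refl

  InOrbit-sym : ∀ {x y} → x ~ y → y ~ x
  InOrbit-sym (π , aut , πx≡y) =
    flip π , IsAut-flip {π} aut , trans (cong (π ⟨$⟩ˡ_) (sym πx≡y)) (inverseˡ π)

  InOrbit-trans : ∀ {x y z} → x ~ y → y ~ z → x ~ z
  InOrbit-trans (π , autπ , πx≡y) (ρ , autρ , ρy≡z) =
    π ∘ₚ ρ , IsAut-∘ₚ {π} {ρ} autπ autρ , trans (cong (ρ ⟨$⟩ʳ_) πx≡y) ρy≡z

  AutTables : Fin n → Fin n → Vec (Fin n) n → Vec (Fin n) n → Set
  AutTables y z v w =
    (∀ i → lookup v (lookup w i) ≡ i) × (∀ i → lookup w (lookup v i) ≡ i) ×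
    (∀ i j → adj G (lookup v i) (lookup v j) ≡ adj G i j) × lookup v y ≡ z

  autTables? : ∀ y z v w → Dec (AutTables y z v w)
  autTables? y z v w =
    all? (λ i → lookup v (lookup w i) ≟ i) ×-dec all? (λ i → lookup w (lookup v i) ≟ i) ×-dec
    all? (λ i → all? λ j → adj G (lookup v i) (lookup v j) Bool.≟ adj G i j) ×-dec
    lookup v y ≟ z

  AutTables⇒InOrbit : ∀ {y z v w} → AutTables y z v w → y ~ z
  AutTables⇒InOrbit {v = v} {w} (vw≗id , wv≗id , aut , vy≡z) =
    permutation (lookup v) (lookup w) vw≗id wv≗id , aut , vy≡z

  InOrbit⇒AutTables : ∀ {y z} → y ~ z → ∃[ v ] ∃[ w ] AutTables y z v w
  InOrbit⇒AutTables {y} (π , aut , πy≡z) =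
    tabulate πʳ , tabulate πˡ ,
    (λ i → trans (table πʳ _) (trans (cong πʳ (table πˡ i)) (inverseʳ π))) ,
    (λ i → trans (table πˡ _) (trans (cong πˡ (table πʳ i)) (inverseˡ π))) ,
    (λ i j → trans (cong₂ (adj G) (table πʳ i) (table πʳ j)) (aut i j)) ,
    trans (table πʳ y) πy≡z
    where
    πʳ = π ⟨$⟩ʳ_
    πˡ = π ⟨$⟩ˡ_
    table = lookup∘tabulate

  InOrbit? : ∀ y z → Dec (y ~ z)
  InOrbit? y z = map′ (λ (v , w , t) → AutTables⇒InOrbit {v = v} {w} t) InOrbit⇒AutTables
    (anyVec? n λ v → anyVec? n (autTables? y z v))

  InOrbitSet? : ∀ A → Decidable (InOrbitSet G A)
  InOrbitSet? A z = any? λ x → (x ∈? A) ×-dec InOrbit? x z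

  InB? : ∀ A → Decidable (InB G A)
  InB? A z = ¬? (InOrbitSet? A z)

  InB-closed : ∀ A {z z′} → InB G A z → z ~ z′ → InB G A z′
  InB-closed A z∈B z~z′ (x , x∈A , x~z′) = z∈B (x , x∈A , InOrbit-trans x~z′ (InOrbit-sym z~z′))

  InOrbit⇒EquivA : ∀ A {x y} → x ~ y → EquivA G A x y
  InOrbit⇒EquivA A x~y z = (λ (x~z , z∈A) → InOrbit-trans (InOrbit-sym x~y) x~z , z∈A)
                         , (λ (y~z , z∈A) → InOrbit-trans x~y y~z , z∈A)

  InB⇒EquivA : ∀ A {x y} → InB G A x → InB G A y → EquivA G A x y
  InB⇒EquivA A x∈B y∈B z = (λ (x~z , z∈A) → ⊥-elim (x∈B (z , z∈A , InOrbit-sym x~z)))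
                         , (λ (y~z , z∈A) → ⊥-elim (y∈B (z , z∈A , InOrbit-sym y~z)))

  EquivA⇒InOrbit : ∀ A {x y} → InOrbitSet G A x → EquivA G A x y → x ~ y
  EquivA⇒InOrbit A (a , a∈A , a~x) x≡y =
    InOrbit-trans (InOrbit-sym a~x) (InOrbit-sym (proj₁ (proj₁ (x≡y a) (InOrbit-sym a~x , a∈A))))

  EquivA⇒InOrbit⊎InB : ∀ A {x y} → EquivA G A x y → x ~ y ⊎ (InB G A x × InB G A y)
  EquivA⇒InOrbit⊎InB A {x} {y} x≡y with InOrbitSet? A x | InOrbitSet? A y
  ... | yes x∈OA | _        = inj₁ (EquivA⇒InOrbit A x∈OA x≡y)
  ... | _        | yes y∈OA = inj₁ (InOrbit-sym (EquivA⇒InOrbit A y∈OA (≃ₛ-sym x≡y)))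
  ... | no x∈B   | no y∈B   = inj₂ (x∈B , y∈B)

  EmptyOrOneOrbit : Pred (Fin n) 0ℓ → Set
  EmptyOrOneOrbit P = IsEmpty P ⊎ IsOneOrbit G P

  EmptyOrOneOrbit⇒InOrbit : ∀ {P w w′} → EmptyOrOneOrbit P → P w → P w′ → w ~ w′
  EmptyOrOneOrbit⇒InOrbit (inj₁ empty)      w∈P _    = ⊥-elim (empty _ w∈P)
  EmptyOrOneOrbit⇒InOrbit (inj₂ (_ , P≃O)) w∈P w′∈P =
    InOrbit-trans (InOrbit-sym (proj₁ (P≃O _) w∈P)) (proj₁ (P≃O _) w′∈P)

  InOrbit⇒EmptyOrOneOrbit : ∀ {P} → Decidable P → (∀ {w w′} → P w → w ~ w′ → P w′) →
    (∀ {w w′} → P w → P w′ → w ~ w′) → EmptyOrOneOrbit P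
  InOrbit⇒EmptyOrOneOrbit P? closed pairwise with any? P?
  ... | no none       = inj₁ λ z z∈P → none (z , z∈P)
  ... | yes (w , w∈P) = inj₂ (w , λ z → pairwise w∈P , closed w∈P)

  EmptyOrOneOrbit⇒EquivA⇒InOrbit : ∀ A {x y} → EmptyOrOneOrbit (InB G A) → EquivA G A x y → x ~ y
  EmptyOrOneOrbit⇒EquivA⇒InOrbit A small x≡y with EquivA⇒InOrbit⊎InB A x≡y
  ... | inj₁ x~y          = x~y
  ... | inj₂ (x∈B , y∈B) = EmptyOrOneOrbit⇒InOrbit small x∈B y∈B

  SameB⊎EmptyOrOneOrbit : Subset n → Subset n → Set
  SameB⊎EmptyOrOneOrbit A₁ A₂ =
    (InB G A₁ ≃ₛ InB G A₂) ⊎ (EmptyOrOneOrbit (InB G A₁) × EmptyOrOneOrbit (InB G A₂))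

  SamePartition-sym : ∀ {A₁ A₂} → SamePartition G A₁ A₂ → SamePartition G A₂ A₁
  SamePartition-sym same x y = swap (same x y)

  SamePartition⇒EmptyOrOneOrbit : ∀ {A₁ A₂ z} → SamePartition G A₁ A₂ →
    InB G A₁ z → ¬ InB G A₂ z → EmptyOrOneOrbit (InB G A₁) × EmptyOrOneOrbit (InB G A₂)
  SamePartition⇒EmptyOrOneOrbit {A₁} {A₂} {z} same z∈B₁ z∉B₂ =
    InOrbit⇒EmptyOrOneOrbit (InB? A₁) (InB-closed A₁)
      (λ w∈B₁ w′∈B₁ → InOrbit-trans (B₁⊆O[z] w∈B₁) (InOrbit-sym (B₁⊆O[z] w′∈B₁))) ,
    InOrbit⇒EmptyOrOneOrbit (InB? A₂) (InB-closed A₂) B₂-pairwise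
    where
    B₁⊆O[z] : ∀ {w} → InB G A₁ w → w ~ z
    B₁⊆O[z] {w} w∈B₁ with EquivA⇒InOrbit⊎InB A₂ (proj₁ (same w z) (InB⇒EquivA A₁ w∈B₁ z∈B₁))
    ... | inj₁ w~z        = w~z
    ... | inj₂ (_ , z∈B₂) = ⊥-elim (z∉B₂ z∈B₂)

    B₂-pairwise : ∀ {w w′} → InB G A₂ w → InB G A₂ w′ → w ~ w′
    B₂-pairwise {w} {w′} w∈B₂ w′∈B₂
      with EquivA⇒InOrbit⊎InB A₁ (proj₂ (same w w′) (InB⇒EquivA A₂ w∈B₂ w′∈B₂))
    ... | inj₁ w~w′       = w~w′
    ... | inj₂ (w∈B₁ , _) = ⊥-elim (z∉B₂ (InB-closed A₂ w∈B₂ (B₁⊆O[z] w∈B₁)))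

  SamePartition⇒SameB⊎EmptyOrOneOrbit : ∀ A₁ A₂ → SamePartition G A₁ A₂ → SameB⊎EmptyOrOneOrbit A₁ A₂
  SamePartition⇒SameB⊎EmptyOrOneOrbit A₁ A₂ same with ≃ₛ⊎differ (InB? A₁) (InB? A₂)
  ... | inj₁ B₁≃B₂                     = inj₁ B₁≃B₂
  ... | inj₂ (_ , inj₁ (z∈B₁ , z∉B₂)) = inj₂ (SamePartition⇒EmptyOrOneOrbit same z∈B₁ z∉B₂)
  ... | inj₂ (_ , inj₂ (z∈B₂ , z∉B₁)) =
    inj₂ (swap (SamePartition⇒EmptyOrOneOrbit (SamePartition-sym same) z∈B₂ z∉B₁))

  SameB⇒EquivA⇒EquivA : ∀ {A₁ A₂ x y} → InB G A₁ ≃ₛ InB G A₂ → EquivA G A₁ x y → EquivA G A₂ x y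
  SameB⇒EquivA⇒EquivA {A₁} {A₂} {x} {y} B₁≃B₂ x≡y with EquivA⇒InOrbit⊎InB A₁ x≡y
  ... | inj₁ x~y          = InOrbit⇒EquivA A₂ x~y
  ... | inj₂ (x∈B , y∈B) = InB⇒EquivA A₂ (proj₁ (B₁≃B₂ x) x∈B) (proj₁ (B₁≃B₂ y) y∈B)

  SameB⊎EmptyOrOneOrbit⇒SamePartition : ∀ A₁ A₂ → SameB⊎EmptyOrOneOrbit A₁ A₂ → SamePartition G A₁ A₂
  SameB⊎EmptyOrOneOrbit⇒SamePartition A₁ A₂ (inj₁ B₁≃B₂) x y =
    SameB⇒EquivA⇒EquivA B₁≃B₂ , SameB⇒EquivA⇒EquivA (≃ₛ-sym B₁≃B₂)
  SameB⊎EmptyOrOneOrbit⇒SamePartition A₁ A₂ (inj₂ (small₁ , small₂)) x y =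
    InOrbit⇒EquivA A₂ ∘ EmptyOrOneOrbit⇒EquivA⇒InOrbit A₁ small₁ ,
    InOrbit⇒EquivA A₁ ∘ EmptyOrOneOrbit⇒EquivA⇒InOrbit A₂ small₂

proposition1p0p4 : ∀ {n : ℕ} (G : Graph n) (A₁ A₂ : Subset n) →
    (SamePartition G A₁ A₂ →
      (InB G A₁ ≃ₛ InB G A₂) ⊎
      ((IsEmpty (InB G A₁) ⊎ IsOneOrbit G (InB G A₁)) × (IsEmpty (InB G A₂) ⊎ IsOneOrbit G (InB G A₂))))
    × (((InB G A₁ ≃ₛ InB G A₂) ⊎
      ((IsEmpty (InB G A₁) ⊎ IsOneOrbit G (InB G A₁)) × (IsEmpty (InB G A₂) ⊎ IsOneOrbit G (InB G A₂))))
      → SamePartition G A₁ A₂)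
proposition1p0p4 G A₁ A₂ =
  SamePartition⇒SameB⊎EmptyOrOneOrbit G A₁ A₂ , SameB⊎EmptyOrOneOrbit⇒SamePartition G A₁ A₂
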